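{- In the Ctrie algorithm described in the context, the following invariants always hold: (INV1) for every inode $in_{l,p}$, $in.main$ is $null$, a cnode $cn_{l,p}$, or a tombed snode; (INV2) for every cnode, the number of set bits in its bitmap equals the length of its array; (INV3) for every cnode $cn_{l,p}$ and every $r<2^W$, bit $r$ of $cn.bmp$ is set if and only if $cn.arr(r)$ is an snode or an inode $in_{l+W,p\cdot r}$.
   Context: A Ctrie with branching width $W$ is a concurrent shared-memory map accessed by threads via atomic reads and single-word CAS. Nodes: an inode has a mutable field $main$; a cnode has a $2^W$-bit bitmap $bmp$ and an array of references to inodes or snodes, both fixed at creation; an snode has a key, value and tomb flag, fixed at creation. For a cnode, $cn.arr(r)=cn.array(\#(((1\ll r)-1)\wedge cn.bmp))$ where $\#$ is bit count and $\wedge$ bitwise AND. A node is at level $l$ if there are $l/W$ cnodes on the path from the root inode to it; the root inode has prefix $\epsilon$, and a node reached from its closest ancestor cnode $cn_{l,q}$ via $cn_{l,q}.arr(r)$ has level $l+W$ and prefix $q\cdot r$; $n_{l,p}$ denotes a node at level $l$ with prefix $p$. In the algorithm every cnode is created either as a cnode containing a single or two snodes (with bitmap bits set at those keys' hashcode chunks), or as a copy of an existing cnode with one entry inserted (and its bit set), one entry removed (and its bit cleared), an entry replaced, null-inode entries removed (bits cleared), or tomb-inode entries replaced by snodes; every inode is created with $main$ a cnode; and every write to an inode's $main$ is a CAS whose new value is a cnode, $null$, or a tombed snode (the latter produced by compression or weak tombing of a cnode with a single remaining singleton entry). -}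

module Defs where

open import Data.Nat using (ℕ; zero; suc; _+_; _^_; _<_; _<ᵇ_; _≡ᵇ_)
open import Data.Bool using (Bool; true; false; _∧_; not; if_then_else_)
open import Data.Fin using (Fin; toℕ; _≟_)
open import Data.Vec using (Vec; lookup; tabulate; _[_]≔_; replicate; toList)
open import Data.List using (List; []; _∷_; _∷ʳ_; length; map; zip; filterᵇ; allFin)
open import Data.List.Membership.Propositional using (_∈_)
open import Data.List.Relation.Binary.Pointwise using (Pointwise)
open import Data.Maybe using (Maybe; just; nothing)
open import Data.Product using (Σ; ∃; _×_; _,_; proj₁; proj₂)
open import Data.Sum using (_⊎_)
open import Data.Unit using (⊤)
open import Data.Empty using (⊥)
open import Relation.Binary.PropositionalEquality using (_≡_)
open import Relation.Binary.Construct.Closure.ReflexiveTransitive using (Star)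

popcount : ∀ {n} → Vec Bool n → ℕ
popcount Vec.[] = 0
popcount (true  Vec.∷ bs) = suc (popcount bs)
popcount (false Vec.∷ bs) = popcount bs

nth : ∀ {A : Set} → List A → ℕ → Maybe A
nth []       _       = nothing
nth (x ∷ xs) zero    = just x
nth (x ∷ xs) (suc i) = nth xs i

insAt : ∀ {A : Set} → ℕ → A → List A → List A
insAt zero    y xs       = y ∷ xs
insAt (suc i) y []       = y ∷ []
insAt (suc i) y (x ∷ xs) = x ∷ insAt i y xs

delAt : ∀ {A : Set} → ℕ → List A → List A
delAt _       []       = []
delAt zero    (x ∷ xs) = xs
delAt (suc i) (x ∷ xs) = x ∷ delAt i xs

setAt : ∀ {A : Set} → ℕ → A → List A → List A
setAt _       y []       = []
setAt zero    y (x ∷ xs) = y ∷ xs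
setAt (suc i) y (x ∷ xs) = x ∷ setAt i y xs

module Ctrie (W : ℕ) (K V : Set) where

  Pos : Set
  Pos = Fin (2 ^ W)

  -- a 2^W-bit bitmap; bit r is  lookup bmp r
  Bitmap : Set
  Bitmap = Vec Bool (2 ^ W)

  -- inodes are identified by their address in the heap
  Addr : Set
  Addr = ℕ

  record SNode : Set where
    constructor mkSN
    field
      key  : K
      val  : V
      tomb : Bool
  open SNode public

  data Entry : Set where
    eI : Addr → Entry
    eS : SNode → Entry

  record CNode : Set where
    constructor mkCN
    field
      bmp   : Bitmap
      array : List Entry
  open CNode public

  data Node : Set where
    inodeN : Addr → Node
    cnodeN : CNode → Node
    snodeN : SNode → Node

  -- ((1 << r) - 1) ∧ bmp
  maskBelow : Pos → Bitmap → Bitmap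
  maskBelow r b = tabulate (λ i → (toℕ i <ᵇ toℕ r) ∧ lookup b i)

  -- cn.arr(r) = cn.array(#(((1 << r) - 1) ∧ cn.bmp))   (nothing if out of bounds)
  arr : CNode → Pos → Maybe Entry
  arr cn r = nth (array cn) (popcount (maskBelow r (bmp cn)))

  bitSet : Bitmap → Pos → Bitmap
  bitSet b r = b [ r ]≔ true

  bitClear : Bitmap → Pos → Bitmap
  bitClear b r = b [ r ]≔ false

  emptyBmp : Bitmap
  emptyBmp = replicate (2 ^ W) false

  -- set bit positions in increasing order
  positions : Bitmap → List Pos
  positions b = filterᵇ (lookup b) (allFin (2 ^ W))

  isInode : Entry → Set
  isInode e = ∃ λ a → e ≡ eI a

  isSnode : Entry → Set
  isSnode e = ∃ λ sn → e ≡ eS sn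

  record State : Set where
    constructor mkState
    field
      size   : ℕ                 -- inodes 0 .. size-1 are allocated
      main   : Addr → Maybe Node  -- main field of each inode (nothing = null)
      cnodes : List CNode         -- all cnodes created so far
  open State public

  root : Addr
  root = 0

  emptyCN : CNode
  emptyCN = mkCN emptyBmp []

  init : State
  init = mkState 1 (λ _ → just (cnodeN emptyCN)) (emptyCN ∷ [])

  ValidEntry : State → Entry → Set
  ValidEntry s (eI a)  = a < size s
  ValidEntry s (eS _)  = ⊤

  addCN : State → CNode → State
  addCN s cn = mkState (size s) (main s) (cn ∷ cnodes s)

  writeMain : State → Addr → Maybe Node → State
  writeMain s a v = mkState (size s) (λ b → if b ≡ᵇ a then v else main s b) (cnodes s)

  AllowedWrite : State → Maybe Node → Set
  AllowedWrite s nothing             = ⊤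
  AllowedWrite s (just (inodeN _))   = ⊥
  AllowedWrite s (just (cnodeN cn))  = cn ∈ cnodes s
  AllowedWrite s (just (snodeN sn))  = tomb sn ≡ true

  rank : Pos → CNode → ℕ
  rank r cn = popcount (maskBelow r (bmp cn))

  Resurrected : Entry → Entry → Set
  Resurrected e e′ = (e′ ≡ e) ⊎ (isInode e × isSnode e′)

  -- one atomic step of the algorithm (reads and failed CASes do not change the state)
  data Step (s : State) : State → Set where
    newSingle : ∀ (r : Pos) (sn : SNode) →
      Step s (addCN s (mkCN (bitSet emptyBmp r) (eS sn ∷ [])))
    newTwo : ∀ (r₁ r₂ : Pos) (sn₁ sn₂ : SNode) → toℕ r₁ < toℕ r₂ →
      Step s (addCN s (mkCN (bitSet (bitSet emptyBmp r₁) r₂) (eS sn₁ ∷ eS sn₂ ∷ [])))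
    copyInsert : ∀ (cn : CNode) (r : Pos) (e : Entry) → cn ∈ cnodes s →
      lookup (bmp cn) r ≡ false → ValidEntry s e →
      Step s (addCN s (mkCN (bitSet (bmp cn) r) (insAt (rank r cn) e (array cn))))
    copyRemove : ∀ (cn : CNode) (r : Pos) → cn ∈ cnodes s →
      lookup (bmp cn) r ≡ true →
      Step s (addCN s (mkCN (bitClear (bmp cn) r) (delAt (rank r cn) (array cn))))
    copyReplace : ∀ (cn : CNode) (r : Pos) (e : Entry) → cn ∈ cnodes s →
      lookup (bmp cn) r ≡ true → ValidEntry s e →
      Step s (addCN s (mkCN (bmp cn) (setAt (rank r cn) e (array cn))))
    copyContract : ∀ (cn : CNode) (drop : Pos → Bool) → cn ∈ cnodes s →
      (∀ r → drop r ≡ true → (lookup (bmp cn) r ≡ true) × (∃ λ a → arr cn r ≡ just (eI a))) →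
      Step s (addCN s (mkCN (tabulate (λ i → lookup (bmp cn) i ∧ not (drop i)))
                            (map proj₂ (filterᵇ (λ p → not (drop (proj₁ p)))
                                                (zip (positions (bmp cn)) (array cn))))))
    copyResurrect : ∀ (cn : CNode) (arr′ : List Entry) → cn ∈ cnodes s →
      Pointwise Resurrected (array cn) arr′ →
      Step s (addCN s (mkCN (bmp cn) arr′))
    newInode : ∀ (cn : CNode) → cn ∈ cnodes s →
      Step s (mkState (suc (size s))
                      (λ b → if b ≡ᵇ size s then just (cnodeN cn) else main s b)
                      (cnodes s))
    cas : ∀ (a : Addr) (expected new : Maybe Node) → a < size s →
      main s a ≡ expected → AllowedWrite s new →
      Step s (writeMain s a new)

  Reachable : State → Set
  Reachable s = Star Step init s

  -- Levels and prefixes:  AtI s l p a  means inode a is  in_{l,p},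
  -- AtC s l p cn  means cnode cn is  cn_{l,p}  (via paths from the root inode).

  mutual
    data AtI (s : State) : ℕ → List Pos → Addr → Set where
      atRoot  : AtI s 0 [] root
      atChild : ∀ {l p cn r a} → AtC s l p cn → arr cn r ≡ just (eI a) →
                AtI s (l + W) (p ∷ʳ r) a

    data AtC (s : State) : ℕ → List Pos → CNode → Set where
      atMain : ∀ {l p a cn} → AtI s l p a → main s a ≡ just (cnodeN cn) → AtC s l p cn

  INV1 : State → Set
  INV1 s = ∀ l p a → AtI s l p a →
      (main s a ≡ nothing)
    ⊎ (∃ λ cn → main s a ≡ just (cnodeN cn) × AtC s l p cn)
    ⊎ (∃ λ sn → main s a ≡ just (snodeN sn) × tomb sn ≡ true)

  INV2 : State → Set
  INV2 s = ∀ cn → cn ∈ cnodes s → popcount (bmp cn) ≡ length (array cn)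

  INV3 : State → Set
  INV3 s = ∀ l p cn → AtC s l p cn → ∀ (r : Pos) → lookup (bmp cn) r ≡ true →
      (∃ λ sn → arr cn r ≡ just (eS sn))
    ⊎ (∃ λ a → arr cn r ≡ just (eI a) × a < size s × AtI s (l + W) (p ∷ʳ r) a)

-- The invariants follow from a stronger one about every cnode ever created, not only the ones
-- reachable from the root: each created cnode has as many set bits as array entries and refers
-- only to allocated inodes, and every main field holds null, a created cnode or a tombed snode.
-- Every step preserves this (the copy steps change the bit count and the array length in
-- lockstep). A cnode met along a path from the root is a created one, so a set bit r has its
-- array index in range, and cn.arr(r) is an snode or an allocated inode, the child in_{l+W,p·r}.
module Submission where

open import Defs
open import Data.Nat using (ℕ; zero; suc; _^_; _<_; _≤_; z≤n; s≤s; _<ᵇ_; _≡ᵇ_)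
open import Data.Nat.Properties using (≤-refl; ≤-reflexive; ≤-trans; n≤1+n; suc-injective)
open import Data.Bool using (Bool; true; false; _∧_; not; if_then_else_)
open import Data.Fin using (Fin; toℕ; zero; suc)
open import Data.Fin.Properties using (<⇒≢)
open import Data.Vec as Vec using (Vec; lookup; _[_]≔_; replicate)
open import Data.Vec.Properties using (lookup-replicate; lookup∘tabulate; lookup∘update′; tabulate∘lookup)
open import Data.List as List using (List; []; _∷_; length; map; zip; filterᵇ)
open import Data.List.Relation.Unary.All as All using (All; []; _∷_)
open import Data.List.Membership.Propositional using (_∈_)
open import Data.List.Relation.Unary.Any using (here; there)
open import Data.List.Relation.Binary.Pointwise using (Pointwise; []; _∷_; Pointwise-length)
open import Data.Maybe using (just; nothing)
open import Data.Product using (∃; _×_; _,_; proj₁; proj₂)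
open import Data.Sum using (inj₁; inj₂)
open import Data.Unit using (tt)
open import Function using (id; _∘_)
open import Relation.Binary.PropositionalEquality
open import Relation.Binary.Construct.Closure.ReflexiveTransitive using (Star; ε; _◅_)

private
  variable
    A B : Set
    n : ℕ

popcount-allFalse : (b : Vec Bool n) → (∀ i → lookup b i ≡ false) → popcount b ≡ 0
popcount-allFalse Vec.[]          _       = refl
popcount-allFalse (true  Vec.∷ b) allFalse with () ← allFalse zero
popcount-allFalse (false Vec.∷ b) allFalse = popcount-allFalse b (allFalse ∘ suc)

popcount-replicate-false : ∀ n → popcount (replicate n false) ≡ 0
popcount-replicate-false n = popcount-allFalse (replicate n false) (λ i → lookup-replicate i false)

popcount-[]≔true : (b : Vec Bool n) (r : Fin n) → lookup b r ≡ false →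
                   popcount (b [ r ]≔ true) ≡ suc (popcount b)
popcount-[]≔true (false Vec.∷ b) zero    refl = refl
popcount-[]≔true (true  Vec.∷ b) (suc r) br   = cong suc (popcount-[]≔true b r br)
popcount-[]≔true (false Vec.∷ b) (suc r) br   = popcount-[]≔true b r br

popcount-[]≔false : (b : Vec Bool n) (r : Fin n) → lookup b r ≡ true →
                    popcount b ≡ suc (popcount (b [ r ]≔ false))
popcount-[]≔false (true  Vec.∷ b) zero    refl = refl
popcount-[]≔false (true  Vec.∷ b) (suc r) br   = cong suc (popcount-[]≔false b r br)
popcount-[]≔false (false Vec.∷ b) (suc r) br   = popcount-[]≔false b r br

popcount-tabulate : (f : A → Bool) (g : Fin n → A) →
                    popcount (Vec.tabulate (f ∘ g)) ≡ length (filterᵇ f (List.tabulate g))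
popcount-tabulate {n = zero}  f g = refl
popcount-tabulate {n = suc n} f g with f (g zero)
... | true  = cong suc (popcount-tabulate f (g ∘ suc))
... | false = popcount-tabulate f (g ∘ suc)

popcount-below<popcount : (b : Vec Bool n) (r : Fin n) → lookup b r ≡ true →
                          popcount (Vec.tabulate (λ i → (toℕ i <ᵇ toℕ r) ∧ lookup b i)) < popcount b
popcount-below<popcount {n = suc n} (true Vec.∷ b) zero refl =
  s≤s (≤-trans (≤-reflexive (popcount-allFalse (Vec.tabulate {n = n} (λ _ → false)) (lookup∘tabulate _))) z≤n)
popcount-below<popcount (true  Vec.∷ b) (suc r) br = s≤s (popcount-below<popcount b r br)
popcount-below<popcount (false Vec.∷ b) (suc r) br = popcount-below<popcount b r br

length-filterᵇ-filterᵇ : (p q : A → Bool) (xs : List A) →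
                         length (filterᵇ q (filterᵇ p xs)) ≡ length (filterᵇ (λ x → p x ∧ q x) xs)
length-filterᵇ-filterᵇ p q [] = refl
length-filterᵇ-filterᵇ p q (x ∷ xs) with p x
... | false = length-filterᵇ-filterᵇ p q xs
... | true with q x
...   | true  = cong suc (length-filterᵇ-filterᵇ p q xs)
...   | false = length-filterᵇ-filterᵇ p q xs

length-map-proj₂-filterᵇ-zip : (f : A → Bool) (xs : List A) (ys : List B) → length xs ≡ length ys →
  length (map proj₂ (filterᵇ (f ∘ proj₁) (zip xs ys))) ≡ length (filterᵇ f xs)
length-map-proj₂-filterᵇ-zip f []       []       _  = refl
length-map-proj₂-filterᵇ-zip f (x ∷ xs) (y ∷ ys) eq with f x
... | true  = cong suc (length-map-proj₂-filterᵇ-zip f xs ys (suc-injective eq))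
... | false = length-map-proj₂-filterᵇ-zip f xs ys (suc-injective eq)

All-map-proj₂-filterᵇ-zip : ∀ {P : B → Set} (g : A × B → Bool) (xs : List A) {ys : List B} →
  All P ys → All P (map proj₂ (filterᵇ g (zip xs ys)))
All-map-proj₂-filterᵇ-zip g []       _          = []
All-map-proj₂-filterᵇ-zip g (x ∷ xs) []         = []
All-map-proj₂-filterᵇ-zip g (x ∷ xs) {y ∷ _} (py ∷ pys) with g (x , y)
... | true  = py ∷ All-map-proj₂-filterᵇ-zip g xs pys
... | false = All-map-proj₂-filterᵇ-zip g xs pys

length-insAt : ∀ i (y : A) xs → length (insAt i y xs) ≡ suc (length xs)
length-insAt zero    y xs       = refl
length-insAt (suc i) y []       = refl
length-insAt (suc i) y (x ∷ xs) = cong suc (length-insAt i y xs)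

length-delAt : ∀ i (xs : List A) → i < length xs → length xs ≡ suc (length (delAt i xs))
length-delAt zero    (x ∷ xs) _         = refl
length-delAt (suc i) (x ∷ xs) (s≤s i<) = cong suc (length-delAt i xs i<)

length-setAt : ∀ i (y : A) xs → length (setAt i y xs) ≡ length xs
length-setAt i       y []       = refl
length-setAt zero    y (x ∷ xs) = refl
length-setAt (suc i) y (x ∷ xs) = cong suc (length-setAt i y xs)

module _ {P : A → Set} where

  All-insAt : ∀ i {y} xs → P y → All P xs → All P (insAt i y xs)
  All-insAt zero    xs       py pxs        = py ∷ pxs
  All-insAt (suc i) []       py []         = py ∷ []
  All-insAt (suc i) (x ∷ xs) py (px ∷ pxs) = px ∷ All-insAt i xs py pxs

  All-delAt : ∀ i xs → All P xs → All P (delAt i xs)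
  All-delAt i       []       []         = []
  All-delAt zero    (x ∷ xs) (px ∷ pxs) = pxs
  All-delAt (suc i) (x ∷ xs) (px ∷ pxs) = px ∷ All-delAt i xs pxs

  All-setAt : ∀ i {y} xs → P y → All P xs → All P (setAt i y xs)
  All-setAt i       []       py []         = []
  All-setAt zero    (x ∷ xs) py (px ∷ pxs) = py ∷ pxs
  All-setAt (suc i) (x ∷ xs) py (px ∷ pxs) = px ∷ All-setAt i xs py pxs

  All-nth : ∀ i xs → All P xs → i < length xs → ∃ λ x → nth xs i ≡ just x × P x
  All-nth zero    (x ∷ xs) (px ∷ _)   _        = x , refl , px
  All-nth (suc i) (x ∷ xs) (_  ∷ pxs) (s≤s i<) = All-nth i xs pxs i<

module Invariants (W : ℕ) (K V : Set) where
  open Ctrie W K V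

  record WellFormed (s : State) (cn : CNode) : Set where
    constructor wellFormed
    field
      popcount≡length : popcount (bmp cn) ≡ length (array cn)
      entries-valid   : All (ValidEntry s) (array cn)

  record Invariant (s : State) : Set where
    field
      main-allowed     : ∀ a → AllowedWrite s (main s a)
      cnode-wellFormed : ∀ {cn} → cn ∈ cnodes s → WellFormed s cn
  open Invariant
  open WellFormed

  ValidEntry-mono : ∀ {s s′} → size s ≤ size s′ → ∀ e → ValidEntry s e → ValidEntry s′ e
  ValidEntry-mono le (eI a) a< = ≤-trans a< le
  ValidEntry-mono le (eS _) _  = tt

  AllowedWrite-mono : ∀ {s s′} → (∀ {cn} → cn ∈ cnodes s → cn ∈ cnodes s′) →
                      ∀ x → AllowedWrite s x → AllowedWrite s′ x
  AllowedWrite-mono ⊆ nothing            w = w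
  AllowedWrite-mono ⊆ (just (cnodeN cn)) w = ⊆ w
  AllowedWrite-mono ⊆ (just (snodeN sn)) w = w

  AllowedWrite-if : ∀ {s} b {x y} → AllowedWrite s x → AllowedWrite s y →
                    AllowedWrite s (if b then x else y)
  AllowedWrite-if true  wx _  = wx
  AllowedWrite-if false _  wy = wy

  WellFormed-mono : ∀ {s s′} → size s ≤ size s′ → ∀ {cn} → WellFormed s cn → WellFormed s′ cn
  WellFormed-mono le (wellFormed count valid) = wellFormed count (All.map (ValidEntry-mono le _) valid)

  rank<length : ∀ {s cn} → WellFormed s cn → ∀ r → lookup (bmp cn) r ≡ true →
                rank r cn < length (array cn)
  rank<length {cn = cn} (wellFormed count _) r br = subst (_ <_) count (popcount-below<popcount (bmp cn) r br)

  length-positions : ∀ b → length (positions b) ≡ popcount b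
  length-positions b = trans (sym (popcount-tabulate (lookup b) id)) (cong popcount (tabulate∘lookup b))

  addCN-invariant : ∀ {s cn} → Invariant s → WellFormed s cn → Invariant (addCN s cn)
  addCN-invariant {s} I wf .main-allowed a = AllowedWrite-mono there (main s a) (main-allowed I a)
  addCN-invariant I wf .cnode-wellFormed (here refl) = WellFormed-mono ≤-refl wf
  addCN-invariant I wf .cnode-wellFormed (there cn∈) = WellFormed-mono ≤-refl (cnode-wellFormed I cn∈)

  singleton-wellFormed : ∀ {s} r sn → WellFormed s (mkCN (bitSet emptyBmp r) (eS sn ∷ []))
  singleton-wellFormed r sn = wellFormed
    (trans (popcount-[]≔true emptyBmp r (lookup-replicate r false))
           (cong suc (popcount-replicate-false (2 ^ W))))
    (tt ∷ [])

  pair-wellFormed : ∀ {s} r₁ r₂ sn₁ sn₂ → toℕ r₁ < toℕ r₂ →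
    WellFormed s (mkCN (bitSet (bitSet emptyBmp r₁) r₂) (eS sn₁ ∷ eS sn₂ ∷ []))
  pair-wellFormed {s} r₁ r₂ sn₁ sn₂ r₁<r₂ = wellFormed
    (trans (popcount-[]≔true (bitSet emptyBmp r₁) r₂ r₂-clear)
           (cong suc (popcount≡length (singleton-wellFormed {s} r₁ sn₁))))
    (tt ∷ tt ∷ [])
    where
    r₂-clear : lookup (bitSet emptyBmp r₁) r₂ ≡ false
    r₂-clear = trans (lookup∘update′ (<⇒≢ r₁<r₂ ∘ sym) emptyBmp true) (lookup-replicate r₂ false)

  contract-wellFormed : ∀ {s cn} (drop : Pos → Bool) → WellFormed s cn →
    WellFormed s (mkCN (Vec.tabulate (λ i → lookup (bmp cn) i ∧ not (drop i)))
                       (map proj₂ (filterᵇ (λ p → not (drop (proj₁ p))) (zip (positions (bmp cn)) (array cn)))))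
  contract-wellFormed {cn = cn} drop (wellFormed count valid) = wellFormed
    (begin
      popcount (Vec.tabulate (λ i → lookup (bmp cn) i ∧ keep i))
        ≡⟨ popcount-tabulate (λ i → lookup (bmp cn) i ∧ keep i) id ⟩
      length (filterᵇ (λ i → lookup (bmp cn) i ∧ keep i) (List.allFin _))
        ≡⟨ length-filterᵇ-filterᵇ (lookup (bmp cn)) keep (List.allFin _) ⟨
      length (filterᵇ keep (positions (bmp cn)))
        ≡⟨ length-map-proj₂-filterᵇ-zip keep (positions (bmp cn)) (array cn)
             (trans (length-positions (bmp cn)) count) ⟨
      length (map proj₂ (filterᵇ (keep ∘ proj₁) (zip (positions (bmp cn)) (array cn))))
    ∎)
    (All-map-proj₂-filterᵇ-zip _ (positions (bmp cn)) valid)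
    where
    open ≡-Reasoning
    keep : Pos → Bool
    keep i = not (drop i)

  insert-wellFormed : ∀ {s} cn r e → lookup (bmp cn) r ≡ false → ValidEntry s e → WellFormed s cn →
    WellFormed s (mkCN (bitSet (bmp cn) r) (insAt (rank r cn) e (array cn)))
  insert-wellFormed cn r e br v (wellFormed count valid) = wellFormed
    (trans (popcount-[]≔true (bmp cn) r br) (trans (cong suc count) (sym (length-insAt (rank r cn) e (array cn)))))
    (All-insAt (rank r cn) (array cn) v valid)

  remove-wellFormed : ∀ {s} cn r → lookup (bmp cn) r ≡ true → WellFormed s cn →
    WellFormed s (mkCN (bitClear (bmp cn) r) (delAt (rank r cn) (array cn)))
  remove-wellFormed cn r br wf@(wellFormed count valid) = wellFormed
    (suc-injective (begin
      suc (popcount (bitClear (bmp cn) r))        ≡⟨ popcount-[]≔false (bmp cn) r br ⟨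
      popcount (bmp cn)                           ≡⟨ count ⟩
      length (array cn)                           ≡⟨ length-delAt (rank r cn) (array cn) (rank<length wf r br) ⟩
      suc (length (delAt (rank r cn) (array cn))) ∎))
    (All-delAt (rank r cn) (array cn) valid)
    where open ≡-Reasoning

  replace-wellFormed : ∀ {s} cn r e → ValidEntry s e → WellFormed s cn →
    WellFormed s (mkCN (bmp cn) (setAt (rank r cn) e (array cn)))
  replace-wellFormed cn r e v (wellFormed count valid) = wellFormed
    (trans count (sym (length-setAt (rank r cn) e (array cn))))
    (All-setAt (rank r cn) (array cn) v valid)

  resurrect-wellFormed : ∀ {s} cn {arr′} → Pointwise Resurrected (array cn) arr′ → WellFormed s cn →
    WellFormed s (mkCN (bmp cn) arr′)
  resurrect-wellFormed cn rs (wellFormed count valid) = wellFormed (trans count (Pointwise-length rs)) (go rs valid)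
    where
    go : ∀ {s xs ys} → Pointwise Resurrected xs ys → All (ValidEntry s) xs → All (ValidEntry s) ys
    go []                         []       = []
    go (inj₁ refl ∷ rs)           (v ∷ vs) = v ∷ go rs vs
    go (inj₂ (_ , _ , refl) ∷ rs) (_ ∷ vs) = tt ∷ go rs vs

  step-invariant : ∀ {s s′} → Step s s′ → Invariant s → Invariant s′
  step-invariant (newSingle r sn) I = addCN-invariant I (singleton-wellFormed r sn)
  step-invariant (newTwo r₁ r₂ sn₁ sn₂ r₁<r₂) I = addCN-invariant I (pair-wellFormed r₁ r₂ sn₁ sn₂ r₁<r₂)
  step-invariant (copyInsert cn r e cn∈ br v) I =
    addCN-invariant I (insert-wellFormed cn r e br v (cnode-wellFormed I cn∈))
  step-invariant (copyRemove cn r cn∈ br) I =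
    addCN-invariant I (remove-wellFormed cn r br (cnode-wellFormed I cn∈))
  step-invariant (copyReplace cn r e cn∈ _ v) I =
    addCN-invariant I (replace-wellFormed cn r e v (cnode-wellFormed I cn∈))
  step-invariant (copyContract cn drop cn∈ _) I =
    addCN-invariant I (contract-wellFormed drop (cnode-wellFormed I cn∈))
  step-invariant (copyResurrect cn _ cn∈ rs) I =
    addCN-invariant I (resurrect-wellFormed cn rs (cnode-wellFormed I cn∈))
  step-invariant {s} (newInode cn cn∈) I = record
    { main-allowed     = λ a → AllowedWrite-if (a ≡ᵇ size s) cn∈ (AllowedWrite-mono id (main s a) (main-allowed I a))
    ; cnode-wellFormed = WellFormed-mono (n≤1+n (size s)) ∘ cnode-wellFormed I
    }
  step-invariant {s} (cas a _ new _ _ allowed) I = record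
    { main-allowed     = λ b → AllowedWrite-if (b ≡ᵇ a) (AllowedWrite-mono id new allowed)
                                                         (AllowedWrite-mono id (main s b) (main-allowed I b))
    ; cnode-wellFormed = WellFormed-mono ≤-refl ∘ cnode-wellFormed I
    }

  init-invariant : Invariant init
  init-invariant .main-allowed _ = here refl
  init-invariant .cnode-wellFormed (here refl) = wellFormed (popcount-replicate-false (2 ^ W)) []

  Star-invariant : ∀ {s s′} → Star Step s s′ → Invariant s → Invariant s′
  Star-invariant ε          I = I
  Star-invariant (st ◅ sts) I = Star-invariant sts (step-invariant st I)

  module _ {s : State} (I : Invariant s) where

    AtC⇒created : ∀ {l p cn} → AtC s l p cn → cn ∈ cnodes s
    AtC⇒created (atMain {a = a} _ main≡) = subst (AllowedWrite s) main≡ (main-allowed I a)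

    invariant⇒INV1 : INV1 s
    invariant⇒INV1 l p a at with main s a in main≡ | main-allowed I a
    ... | nothing          | _    = inj₁ refl
    ... | just (cnodeN cn) | _    = inj₂ (inj₁ (cn , refl , atMain at main≡))
    ... | just (snodeN sn) | tomb = inj₂ (inj₂ (sn , refl , tomb))

    invariant⇒INV2 : INV2 s
    invariant⇒INV2 cn cn∈ = popcount≡length (cnode-wellFormed I cn∈)

    invariant⇒INV3 : INV3 s
    invariant⇒INV3 l p cn at r br
      with All-nth (rank r cn) (array cn) (entries-valid wf) (rank<length wf r br)
      where wf = cnode-wellFormed I (AtC⇒created at)
    ... | eS sn , arr≡ , _  = inj₁ (sn , arr≡)
    ... | eI a  , arr≡ , a< = inj₂ (a , arr≡ , a< , atChild at arr≡)

lemma3 : ∀ (W : ℕ) (K V : Set) (s : Ctrie.State W K V) → Ctrie.Reachable W K V s →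
    Ctrie.INV1 W K V s × Ctrie.INV2 W K V s × Ctrie.INV3 W K V s
lemma3 W K V s reachable = invariant⇒INV1 I , invariant⇒INV2 I , invariant⇒INV3 I
  where
  open Invariants W K V
  I : Invariant s
  I = Star-invariant reachable init-invariant
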